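{- Let $F$ be a field of characteristic zero and let $1_\psi, 2_\psi, 3_\psi,\dots$ be nonzero elements of $F$. Then for all integers $i\ge j\ge 0$, $$\sum_{k=j}^{i}\binom{i}{k}_\psi\binom{k}{j}_\psi=(1+_\psi 1)^{i-j}\binom{i}{j}_\psi .$$
   Context: Notation: $0_\psi!=1$ and $m_\psi!=m_\psi\,(m-1)_\psi!$ for $m\ge1$. The $\psi$-binomial symbol is $\binom{m}{k}_\psi=\frac{m_\psi!}{k_\psi!\,(m-k)_\psi!}$ for $0\le k\le m$. For $m\ge 0$, $(1+_\psi 1)^m=\sum_{k=0}^{m}\binom{m}{k}_\psi$. -}

module Defs where

open import Level using (Level; _⊔_) renaming (suc to lsuc)
open import Data.Nat using (ℕ; zero; suc; _∸_) renaming (_+_ to _+ℕ_)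
open import Relation.Nullary using (¬_)
open import Relation.Binary.PropositionalEquality using (_≡_)
open import Algebra.Bundles using (CommutativeRing)

record Field (c ℓ : Level) : Set (lsuc (c ⊔ ℓ)) where
  field
    commutativeRing : CommutativeRing c ℓ
  open CommutativeRing commutativeRing public
  field
    _⁻¹      : Carrier → Carrier
    0≉1      : ¬ (0# ≈ 1#)
    ⁻¹-inverseʳ : ∀ x → ¬ (x ≈ 0#) → x * (x ⁻¹) ≈ 1#

module FieldDefs {c ℓ : Level} (F : Field c ℓ) where
  open Field F

  natCast : ℕ → Carrier
  natCast zero    = 0#
  natCast (suc n) = 1# + natCast n

  CharZero : Set ℓ
  CharZero = ∀ n → ¬ (natCast (suc n) ≈ 0#)

  -- ψ-factorial: 0_ψ! = 1, m_ψ! = m_ψ · (m-1)_ψ!   (ψ m plays the role of m_ψ)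
  fact : (ℕ → Carrier) → ℕ → Carrier
  fact ψ zero    = 1#
  fact ψ (suc m) = ψ (suc m) * fact ψ m

  -- ψ-binomial: m_ψ! / (k_ψ! (m-k)_ψ!)   (meaningful for k ≤ m)
  binom : (ℕ → Carrier) → ℕ → ℕ → Carrier
  binom ψ m k = fact ψ m * ((fact ψ k * fact ψ (m ∸ k)) ⁻¹)

  -- Σ_{k = a}^{a + n} f k  (n+1 terms)
  sumFrom : ℕ → ℕ → (ℕ → Carrier) → Carrier
  sumFrom a zero    f = f a
  sumFrom a (suc n) f = sumFrom a n f + f (a +ℕ suc n)

  -- (1 +_ψ 1)^m = Σ_{k=0}^{m} binom m k
  onePlusOnePow : (ℕ → Carrier) → ℕ → Carrier
  onePlusOnePow ψ m = sumFrom 0 m (binom ψ m)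

{-# OPTIONS --safe #-}
-- Write i = j + m and k = j + t.  Since all ψ-factorials are nonzero, both
-- binom i k · binom k j and binom m t · binom i j equal the ψ-trinomial
-- coefficient i_ψ! / (j_ψ! t_ψ! (m - t)_ψ!).  Summing over t = 0, …, m and
-- factoring out binom i j leaves Σ_t binom m t = (1 +_ψ 1)^m.
module Submission where

open import Defs
open import Level using (Level)
open import Data.Nat using (ℕ; zero; suc; _≤_; _∸_) renaming (_+_ to _+ℕ_)
import Data.Nat.Properties as ℕ
open import Relation.Nullary using (¬_)
open import Relation.Binary.PropositionalEquality as ≡ using (_≡_)
import Algebra.Solver.CommutativeMonoid as CommutativeMonoidSolver
import Relation.Binary.Reasoning.Setoid as SetoidReasoning

module _ {c ℓ : Level} (F : Field c ℓ) where
  open Field F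
  open FieldDefs F
  open SetoidReasoning setoid
  open CommutativeMonoidSolver *-commutativeMonoid using (solve; _⊕_; _⊜_)

  *-cancel-⁻¹ˡ : ∀ {x} → x ≉ 0# → ∀ y → x * (x ⁻¹ * y) ≈ y
  *-cancel-⁻¹ˡ {x} x≉0 y = begin
    x * (x ⁻¹ * y)  ≈⟨ sym (*-assoc x (x ⁻¹) y) ⟩
    x * x ⁻¹ * y    ≈⟨ *-congʳ (⁻¹-inverseʳ x x≉0) ⟩
    1# * y          ≈⟨ *-identityˡ y ⟩
    y               ∎

  *-≉0 : ∀ {x y} → x ≉ 0# → y ≉ 0# → x * y ≉ 0#
  *-≉0 {x} {y} x≉0 y≉0 xy≈0 = y≉0 (begin
    y               ≈⟨ sym (*-cancel-⁻¹ˡ x≉0 y) ⟩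
    x * (x ⁻¹ * y)  ≈⟨ *-congˡ (*-comm (x ⁻¹) y) ⟩
    x * (y * x ⁻¹)  ≈⟨ sym (*-assoc x y (x ⁻¹)) ⟩
    x * y * x ⁻¹    ≈⟨ *-congʳ xy≈0 ⟩
    0# * x ⁻¹       ≈⟨ zeroˡ (x ⁻¹) ⟩
    0#              ∎)

  ⁻¹-unique : ∀ {x y} → x ≉ 0# → x * y ≈ 1# → x ⁻¹ ≈ y
  ⁻¹-unique {x} {y} x≉0 xy≈1 = begin
    x ⁻¹              ≈⟨ sym (*-identityʳ (x ⁻¹)) ⟩
    x ⁻¹ * 1#         ≈⟨ *-congˡ (sym xy≈1) ⟩
    x ⁻¹ * (x * y)    ≈⟨ *-congˡ (*-comm x y) ⟩
    x ⁻¹ * (y * x)    ≈⟨ *-comm (x ⁻¹) (y * x) ⟩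
    y * x * x ⁻¹      ≈⟨ *-assoc y x (x ⁻¹) ⟩
    y * (x * x ⁻¹)    ≈⟨ *-congˡ (⁻¹-inverseʳ x x≉0) ⟩
    y * 1#            ≈⟨ *-identityʳ y ⟩
    y                 ∎

  ⁻¹-*-distrib : ∀ {x y} → x ≉ 0# → y ≉ 0# → (x * y) ⁻¹ ≈ x ⁻¹ * y ⁻¹
  ⁻¹-*-distrib {x} {y} x≉0 y≉0 = ⁻¹-unique (*-≉0 x≉0 y≉0) (begin
    x * y * (x ⁻¹ * y ⁻¹)    ≈⟨ solve 4 (λ a b a′ b′ → (a ⊕ b) ⊕ (a′ ⊕ b′) ⊜ a ⊕ (a′ ⊕ (b ⊕ b′)))
                                        refl x y (x ⁻¹) (y ⁻¹) ⟩
    x * (x ⁻¹ * (y * y ⁻¹))  ≈⟨ *-cancel-⁻¹ˡ x≉0 (y * y ⁻¹) ⟩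
    y * y ⁻¹                 ≈⟨ ⁻¹-inverseʳ y y≉0 ⟩
    1#                       ∎)

  sumFrom-shift : ∀ a n f → sumFrom a n f ≈ sumFrom 0 n (λ t → f (a +ℕ t))
  sumFrom-shift a zero    f = reflexive (≡.cong f (≡.sym (ℕ.+-identityʳ a)))
  sumFrom-shift a (suc n) f = +-congʳ (sumFrom-shift a n f)

  sumFrom-cong : ∀ a n {f g} → (∀ k → f k ≈ g k) → sumFrom a n f ≈ sumFrom a n g
  sumFrom-cong a zero    f≈g = f≈g a
  sumFrom-cong a (suc n) f≈g = +-cong (sumFrom-cong a n f≈g) (f≈g (a +ℕ suc n))

  sumFrom-*-distribʳ : ∀ a n f x → sumFrom a n f * x ≈ sumFrom a n (λ k → f k * x)
  sumFrom-*-distribʳ a zero    f x = refl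
  sumFrom-*-distribʳ a (suc n) f x =
    trans (distribʳ x _ _) (+-congʳ (sumFrom-*-distribʳ a n f x))

  module _ (ψ : ℕ → Carrier) (ψ≉0 : ∀ n → ψ (suc n) ≉ 0#) where

    fact-≉0 : ∀ n → fact ψ n ≉ 0#
    fact-≉0 zero 1≈0 = 0≉1 (sym 1≈0)
    fact-≉0 (suc n)  = *-≉0 (ψ≉0 n) (fact-≉0 n)

    binom≈factorial-ratio : ∀ m k {n} → m ∸ k ≡ n →
      binom ψ m k ≈ fact ψ m * (fact ψ k ⁻¹ * fact ψ n ⁻¹)
    binom≈factorial-ratio m k ≡.refl = *-congˡ (⁻¹-*-distrib (fact-≉0 k) (fact-≉0 (m ∸ k)))

    binom-*-binom : ∀ j m t →
      binom ψ (j +ℕ m) (j +ℕ t) * binom ψ (j +ℕ t) j ≈ binom ψ m t * binom ψ (j +ℕ m) j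
    binom-*-binom j m t = begin
      binom ψ i k * binom ψ k j
        ≈⟨ *-cong (binom≈factorial-ratio i k (ℕ.[m+n]∸[m+o]≡n∸o j m t))
                  (binom≈factorial-ratio k j (ℕ.m+n∸m≡n j t)) ⟩
      i! * (k! ⁻¹ * [m-t]! ⁻¹) * (k! * (j! ⁻¹ * t! ⁻¹))
        ≈⟨ solve 6 (λ i k k′ a b c → (i ⊕ (k′ ⊕ a)) ⊕ (k ⊕ (b ⊕ c)) ⊜ k ⊕ (k′ ⊕ (i ⊕ (a ⊕ (b ⊕ c)))))
                   refl i! k! (k! ⁻¹) ([m-t]! ⁻¹) (j! ⁻¹) (t! ⁻¹) ⟩
      k! * (k! ⁻¹ * trinomial)
        ≈⟨ *-cancel-⁻¹ˡ (fact-≉0 k) trinomial ⟩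
      trinomial
        ≈⟨ sym (*-cancel-⁻¹ˡ (fact-≉0 m) trinomial) ⟩
      m! * (m! ⁻¹ * trinomial)
        ≈⟨ solve 6 (λ m m′ i a b c → m ⊕ (m′ ⊕ (i ⊕ (a ⊕ (b ⊕ c)))) ⊜ (m ⊕ (c ⊕ a)) ⊕ (i ⊕ (b ⊕ m′)))
                   refl m! (m! ⁻¹) i! ([m-t]! ⁻¹) (j! ⁻¹) (t! ⁻¹) ⟩
      m! * (t! ⁻¹ * [m-t]! ⁻¹) * (i! * (j! ⁻¹ * m! ⁻¹))
        ≈⟨ sym (*-cong (binom≈factorial-ratio m t ≡.refl)
                       (binom≈factorial-ratio i j (ℕ.m+n∸m≡n j m))) ⟩
      binom ψ m t * binom ψ i j
        ∎
      where
        i = j +ℕ m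
        k = j +ℕ t
        i! = fact ψ i
        k! = fact ψ k
        j! = fact ψ j
        m! = fact ψ m
        t! = fact ψ t
        [m-t]! = fact ψ (m ∸ t)
        trinomial = i! * ([m-t]! ⁻¹ * (j! ⁻¹ * t! ⁻¹))

    sum-binom-*-binom : ∀ {i} j m → j +ℕ m ≡ i →
      sumFrom j m (λ k → binom ψ i k * binom ψ k j) ≈ onePlusOnePow ψ m * binom ψ i j
    sum-binom-*-binom j m ≡.refl = begin
      sumFrom j m (λ k → binom ψ (j +ℕ m) k * binom ψ k j)
        ≈⟨ sumFrom-shift j m _ ⟩
      sumFrom 0 m (λ t → binom ψ (j +ℕ m) (j +ℕ t) * binom ψ (j +ℕ t) j)
        ≈⟨ sumFrom-cong 0 m (binom-*-binom j m) ⟩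
      sumFrom 0 m (λ t → binom ψ m t * binom ψ (j +ℕ m) j)
        ≈⟨ sym (sumFrom-*-distribʳ 0 m (binom ψ m) _) ⟩
      onePlusOnePow ψ m * binom ψ (j +ℕ m) j
        ∎

mainTheorem2 : {c ℓ : Level} (F : Field c ℓ) →
    let open Field F in let open FieldDefs F in
    CharZero →
    (ψ : ℕ → Carrier) → (∀ n → ¬ (ψ (suc n) ≈ 0#)) →
    (i j : ℕ) → j ≤ i →
    sumFrom j (i ∸ j) (λ k → binom ψ i k * binom ψ k j)
      ≈ onePlusOnePow ψ (i ∸ j) * binom ψ i j
mainTheorem2 F _ ψ ψ≉0 i j j≤i = sum-binom-*-binom F ψ ψ≉0 j (i ∸ j) (ℕ.m+[n∸m]≡n j≤i)
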